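{- Let $G$ be a finitely generated contracting self-similar group and $S\subseteq G$ a finite generating set closed under restrictions. For every $n\ge 0$, the graph $\Gamma_n$ defined below has no two distinct edges with the same initial vertex, the same terminal vertex and the same color.
   Context: Let $X=\{0,1,\dots,d-1\}$ and $X^*$ the set of finite words over $X$. A self-similar group is a group $G$ of permutations of $X^*$ such that for every $g\in G$ and $x\in X$ there are $h\in G$, $y\in X$ with $g(xw)=y\,h(w)$ for all $w\in X^*$; one writes $\sigma_g(x)=y$ and $g_x=h$ (the restriction of $g$ to $x$), and $g_{xw}=(g_x)_w$. $G$ is contracting if there is a finite $N\subseteq G$ such that for every $g\in G$ there is $k$ with $g_w\in N$ for all words $w$ of length $\ge k$. $S$ is closed under restrictions if $g_x\in S$ for all $g\in S$, $x\in X$. Define graphs $\Gamma_n$ with vertex set $X^n$ and edges colored by $S$: $\Gamma_0$ has the single vertex $\varepsilon$ (empty word) and one $g$-colored loop for each $g\in S$; $\Gamma_{n+1}$ has, for every $g'$-colored edge $u\to v$ of $\Gamma_n$ and every $x,y\in X$ and $h\in S$ with $\sigma_h(x)=y$ and $h_x=g'$, an $h$-colored edge $xu\to yv$ (these are all its edges). (These are the expansions of the VERS $\mathcal R(G,S)$.) -}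

module Defs where

open import Data.Nat using (ℕ; zero; suc; _≤_)
open import Data.Fin using (Fin)
open import Data.List using (List; []; _∷_; length; lookup)
open import Data.List.Membership.Propositional using (_∈_)
open import Data.List.Relation.Unary.Unique.Propositional using (Unique)
open import Data.Product using (Σ; ∃; _×_; _,_; proj₁; proj₂)
open import Relation.Binary.PropositionalEquality using (_≡_)

Word : ℕ → Set
Word d = List (Fin d)

record SelfSimilarGroup (d : ℕ) : Set₁ where
  field
    G        : Set
    act      : G → Word d → Word d
    faithful : ∀ g h → (∀ w → act g w ≡ act h w) → g ≡ h
    e        : G
    _·_      : G → G → G
    inv      : G → G
    act-e    : ∀ w → act e w ≡ w
    act-·    : ∀ g h w → act (g · h) w ≡ act g (act h w)
    act-invˡ : ∀ g w → act (inv g) (act g w) ≡ w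
    act-invʳ : ∀ g w → act g (act (inv g) w) ≡ w
    σ        : G → Fin d → Fin d
    res      : G → Fin d → G
    self-sim : ∀ g x w → act g (x ∷ w) ≡ σ g x ∷ act (res g x) w

  res* : G → Word d → G
  res* g []      = g
  res* g (x ∷ w) = res* (res g x) w

  Contracting : Set
  Contracting = Σ (List G) λ N → ∀ g → ∃ λ k → ∀ w → k ≤ length w → res* g w ∈ N

  data Generated (S : List G) : G → Set where
    gen-e   : Generated S e
    gen-s   : ∀ {s g} → s ∈ S → Generated S g → Generated S (s · g)
    gen-inv : ∀ {s g} → s ∈ S → Generated S g → Generated S (inv s · g)

  -- S (a finite subset, as a duplicate-free list) generates G
  GeneratingSet : List G → Set
  GeneratingSet S = Unique S × (∀ g → Generated S g)

  ClosedUnderRestrictions : List G → Set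
  ClosedUnderRestrictions S = ∀ g x → g ∈ S → res g x ∈ S

  -- Edges form a multiset: an edge of Γ_0 is a choice of
  -- g ∈ S (an index into S); an edge of Γ_{n+1} is a choice of an edge
  -- u → v of Γ_n (colour g'), a letter x and h ∈ S with h_x = g'; it goes
  -- from xu to σ_h(x) v and has colour h.
  module Γ (S : List G) where
    Edge   : ℕ → Set
    source : ∀ n → Edge n → Word d
    target : ∀ n → Edge n → Word d
    colour : ∀ n → Edge n → G

    Edge zero    = Fin (length S)
    Edge (suc n) = Σ (Edge n) λ ε → Σ (Fin d) λ x → Σ (Fin (length S)) λ i →
                     res (lookup S i) x ≡ colour n ε

    source zero    _               = []
    source (suc n) (ε , x , i , _) = x ∷ source n ε
    target zero    _               = []
    target (suc n) (ε , x , i , _) = σ (lookup S i) x ∷ target n ε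
    colour zero    i               = lookup S i
    colour (suc n) (ε , x , i , _) = lookup S i

module Submission where

-- An edge of Γ_{n+1} is determined by its colour h ∈ S, its source letter x
-- and the edge of Γ_n it expands; that edge has colour h_x, source the tail of
-- the source word and target the tail of the target word.  So by induction on
-- n an edge is determined by its source, target and colour, using only that S
-- has no repeated elements.

open import Defs
open import Data.Nat using (ℕ; zero; suc)
open import Data.Fin using (Fin)
open import Data.List using (List; _∷_; length; lookup)
open import Data.List.Properties using (∷-injective)
open import Data.List.Membership.Propositional.Properties using (∈-lookup)
import Data.List.Relation.Unary.All as All
open import Data.List.Relation.Unary.AllPairs using (_∷_)
open import Data.List.Relation.Unary.Unique.Propositional using (Unique)
open import Data.Product using (_,_)
open import Data.Empty using (⊥-elim)
open import Relation.Binary.PropositionalEquality using (_≡_; refl; sym; trans; cong)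
open import Axiom.UniquenessOfIdentityProofs.WithK using (uip)

lookup-injective : ∀ {A : Set} {xs : List A} → Unique xs →
                   ∀ (i j : Fin (length xs)) → lookup xs i ≡ lookup xs j → i ≡ j
lookup-injective {xs = _ ∷ _} _         Fin.zero    Fin.zero    _  = refl
lookup-injective {xs = _ ∷ _} (x∉ ∷ _)  Fin.zero    (Fin.suc j) eq = ⊥-elim (All.lookup x∉ (∈-lookup j) eq)
lookup-injective {xs = _ ∷ _} (x∉ ∷ _)  (Fin.suc i) Fin.zero    eq = ⊥-elim (All.lookup x∉ (∈-lookup i) (sym eq))
lookup-injective {xs = _ ∷ _} (_ ∷ xs!) (Fin.suc i) (Fin.suc j) eq = cong Fin.suc (lookup-injective xs! i j eq)

module _ {d : ℕ} (𝒢 : SelfSimilarGroup d) {S : List (SelfSimilarGroup.G 𝒢)} (S! : Unique S) where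
  open SelfSimilarGroup 𝒢
  open Γ S

  edge-determined : ∀ n (e₁ e₂ : Edge n) →
                    source n e₁ ≡ source n e₂ → target n e₁ ≡ target n e₂ →
                    colour n e₁ ≡ colour n e₂ → e₁ ≡ e₂
  edge-determined zero i j _ _ colour≡ = lookup-injective S! i j colour≡
  edge-determined (suc n) (ε₁ , x₁ , i₁ , res≡₁) (ε₂ , x₂ , i₂ , res≡₂) source≡ target≡ colour≡
    with lookup-injective S! i₁ i₂ colour≡ | ∷-injective source≡ | ∷-injective target≡
  ... | refl | refl , tail-source≡ | _ , tail-target≡
    with edge-determined n ε₁ ε₂ tail-source≡ tail-target≡ (trans (sym res≡₁) res≡₂)
  ... | refl = cong (λ r → ε₁ , x₁ , i₁ , r) (uip res≡₁ res≡₂)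

lemma4p2 : ∀ {d : ℕ} (𝒢 : SelfSimilarGroup d) (S : List (SelfSimilarGroup.G 𝒢)) →
    SelfSimilarGroup.Contracting 𝒢 →
    SelfSimilarGroup.GeneratingSet 𝒢 S →
    SelfSimilarGroup.ClosedUnderRestrictions 𝒢 S →
    ∀ (n : ℕ) (e₁ e₂ : SelfSimilarGroup.Γ.Edge 𝒢 S n) →
    SelfSimilarGroup.Γ.source 𝒢 S n e₁ ≡ SelfSimilarGroup.Γ.source 𝒢 S n e₂ →
    SelfSimilarGroup.Γ.target 𝒢 S n e₁ ≡ SelfSimilarGroup.Γ.target 𝒢 S n e₂ →
    SelfSimilarGroup.Γ.colour 𝒢 S n e₁ ≡ SelfSimilarGroup.Γ.colour 𝒢 S n e₂ →
    e₁ ≡ e₂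
lemma4p2 𝒢 S _ (S! , _) _ = edge-determined 𝒢 S!
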